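{- Let $K$ be a number field and $\mathcal{F}\subseteq K^\times$ the free abelian subgroup generated by a fixed system of fundamental units. Let $H$ be the subgroup of $(K^\times)^6$ of all $(\alpha_{12},\alpha_{21},\alpha_{23},\alpha_{32},\alpha_{31},\alpha_{13})\in\mathcal{F}^6$ for which $\alpha_{12}\alpha_{21}^2\alpha_{23}\alpha_{32}^2\alpha_{31}\alpha_{13}^2$ is a cube in $\mathcal{F}$. Let $R\subseteq K^\times$ be a system of representatives for $K^\times/\mathcal{F}$ and $R_{\mathcal{F}}\subseteq\mathcal{F}$ a system of representatives for $\mathcal{F}/\{\xi^3\mid\xi\in\mathcal{F}\}$. Then \[\mathcal{R}_2:=\bigcup_{\rho\in R_{\mathcal{F}}}(\rho R\times R\times R\times R\times R\times R)\] is a system of representatives for $(K^\times)^6/H$.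
   Context: Coordinates of $(K^\times)^6$ are ordered as $(y_{12},y_{21},y_{23},y_{32},y_{31},y_{13})$, so the first factor $\rho R$ corresponds to $y_{12}$. -}

module Defs where

open import Level using (Level; _⊔_) renaming (suc to lsuc)
open import Algebra.Bundles using (CommutativeRing)
open import Data.Nat using (ℕ; zero; suc)
open import Data.Integer using (ℤ; +_; -[1+_])
open import Data.Fin using (Fin; zero; suc; toℕ)
open import Data.Rational using (ℚ; 0ℚ; 1ℚ) renaming (_+_ to _+ℚ_; _*_ to _*ℚ_)
open import Data.Product using (Σ; ∃; _×_; _,_; proj₁; proj₂)
open import Relation.Binary.PropositionalEquality using (_≡_)
open import Relation.Nullary using (¬_)

∑ : ∀ {c ℓ} (A : CommutativeRing c ℓ) {n : ℕ} → (Fin n → CommutativeRing.Carrier A) → CommutativeRing.Carrier A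
∑ A {zero}  f = CommutativeRing.0# A
∑ A {suc n} f = CommutativeRing._+_ A (f zero) (∑ A (λ i → f (suc i)))

record NumberField (c ℓ : Level) : Set (lsuc (c ⊔ ℓ)) where
  field
    ring : CommutativeRing c ℓ
  open CommutativeRing ring using (Carrier; _≈_; _+_; _*_; -_; 0#; 1#)

  field
    1≉0     : ¬ (1# ≈ 0#)
    inverse : ∀ x → ¬ (x ≈ 0#) → Σ Carrier (λ y → x * y ≈ 1#)
    ι   : ℚ → Carrier
    ι-+ : ∀ p q → ι (p +ℚ q) ≈ ι p + ι q
    ι-* : ∀ p q → ι (p *ℚ q) ≈ ι p * ι q
    ι-1 : ι 1ℚ ≈ 1#
    dim   : ℕ
    basis : Fin dim → Carrier
    spans : ∀ x → Σ (Fin dim → ℚ) (λ a → x ≈ ∑ ring (λ i → ι (a i) * basis i))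
    indep : ∀ (a : Fin dim → ℚ) → ∑ ring (λ i → ι (a i) * basis i) ≈ 0# → ∀ i → a i ≡ 0ℚ

module NF {c ℓ : Level} (K : NumberField c ℓ) where
  open NumberField K
  open CommutativeRing ring using (Carrier; _≈_; _+_; _*_; -_; 0#; 1#)

  ∏ : ∀ {n} → (Fin n → Carrier) → Carrier
  ∏ {zero}  f = 1#
  ∏ {suc n} f = f zero * ∏ (λ i → f (suc i))

  _^_ : Carrier → ℕ → Carrier
  x ^ zero  = 1#
  x ^ suc n = x * (x ^ n)

  fromℕ : ℕ → Carrier
  fromℕ zero    = 0#
  fromℕ (suc n) = 1# + fromℕ n

  fromℤ : ℤ → Carrier
  fromℤ (+ n)      = fromℕ n
  fromℤ -[1+ n ]   = - fromℕ (suc n)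

  IsIntegral : Carrier → Set ℓ
  IsIntegral x = Σ ℕ (λ n → Σ (Fin n → ℤ) (λ a →
    (x ^ n) + ∑ ring (λ i → fromℤ (a i) * (x ^ toℕ i)) ≈ 0#))

  -- x is a unit of the ring of integers O_K (with a chosen inverse in O_K)
  IsUnit : Carrier → Set (c ⊔ ℓ)
  IsUnit x = IsIntegral x × Σ Carrier (λ y → IsIntegral y × (x * y ≈ 1#))

  IsRootOfUnity : Carrier → Set ℓ
  IsRootOfUnity z = Σ ℕ (λ m → z ^ suc m ≈ 1#)

  -- ε^a = ∏ᵢ εᵢ^aᵢ for units εᵢ and integer exponents aᵢ
  -- (negative powers use the inverse in O_K supplied by the unit witness)
  monomialOf : ∀ {r} (ε : Fin r → Carrier) → (∀ i → IsUnit (ε i)) → (Fin r → ℤ) → Carrier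
  monomialOf ε ε-unit a = ∏ (λ i → εpow i (a i))
    where
      εpow : _ → ℤ → Carrier
      εpow i (+ n)    = ε i ^ n
      εpow i -[1+ n ] = proj₁ (proj₂ (ε-unit i)) ^ suc n

  -- A (fixed) system of fundamental units ε₁,…,ε_r: units such that every unit
  -- is ζ·ε₁^a₁⋯ε_r^a_r with ζ a root of unity, the exponents being unique
  -- (i.e. ε₁^a₁⋯ε_r^a_r a root of unity only for a = 0).
  record FundamentalUnits : Set (c ⊔ ℓ) where
    field
      rank : ℕ
      ε    : Fin rank → Carrier
      ε-unit : ∀ i → IsUnit (ε i)

    monomial : (Fin rank → ℤ) → Carrier
    monomial = monomialOf ε ε-unit

    field
      generate : ∀ u → IsUnit u →
        Σ Carrier (λ ζ → IsRootOfUnity ζ × Σ (Fin rank → ℤ) (λ a → u ≈ ζ * monomial a))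
      independent : ∀ (a : Fin rank → ℤ) → IsRootOfUnity (monomial a) → ∀ i → a i ≡ + 0

  -- generic notion: S is a system of representatives for the classes of G
  -- modulo the coset relation _∼_ (x ∼ s meaning x lies in the coset of s),
  -- uniqueness being up to the equality _≋_ of the ambient setoid.
  SystemOfReps : ∀ {a e g r p} {A : Set a} (_≋_ : A → A → Set e)
    (G : A → Set g) (_∼_ : A → A → Set r) (S : A → Set p) → Set (a ⊔ e ⊔ g ⊔ r ⊔ p)
  SystemOfReps {A = A} _≋_ G _∼_ S =
    (∀ s → S s → G s) ×
    (∀ x → G x → Σ A (λ s → S s × (x ∼ s))) ×
    (∀ s t → S s → S t → s ∼ t → s ≋ t)

  NonZero : Carrier → Set ℓ
  NonZero x = ¬ (x ≈ 0#)

  module _ (fu : FundamentalUnits) where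
    open FundamentalUnits fu

    InF : Carrier → Set ℓ
    InF x = Σ (Fin rank → ℤ) (λ a → x ≈ monomial a)

    IsCubeInF : Carrier → Set (c ⊔ ℓ)
    IsCubeInF x = Σ Carrier (λ ξ → InF ξ × (x ≈ ξ ^ 3))

    _∼F_ : Carrier → Carrier → Set (c ⊔ ℓ)
    x ∼F s = Σ Carrier (λ f → InF f × (x ≈ f * s))

    _∼F³_ : Carrier → Carrier → Set (c ⊔ ℓ)
    x ∼F³ s = Σ Carrier (λ ξ → InF ξ × (x ≈ (ξ ^ 3) * s))

    -- 6-tuples, coordinates ordered (12, 21, 23, 32, 31, 13), i.e. indices 0..5
    Tuple6 : Set c
    Tuple6 = Fin 6 → Carrier

    _≋6_ : Tuple6 → Tuple6 → Set ℓ
    x ≋6 y = ∀ i → x i ≈ y i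

    NonZero6 : Tuple6 → Set ℓ
    NonZero6 x = ∀ i → NonZero (x i)

    InH : Tuple6 → Set (c ⊔ ℓ)
    InH α = (∀ i → InF (α i)) ×
      IsCubeInF (α i0 * (α i1 ^ 2) * α i2 * (α i3 ^ 2) * α i4 * (α i5 ^ 2))
      where
        i0 i1 i2 i3 i4 i5 : Fin 6
        i0 = zero
        i1 = suc zero
        i2 = suc (suc zero)
        i3 = suc (suc (suc zero))
        i4 = suc (suc (suc (suc zero)))
        i5 = suc (suc (suc (suc (suc zero))))

    _∼H_ : Tuple6 → Tuple6 → Set (c ⊔ ℓ)
    x ∼H s = Σ Tuple6 (λ h → InH h × (∀ i → x i ≈ h i * s i))

    𝓡₂ : ∀ {p} (R R𝓕 : Carrier → Set p) → Tuple6 → Set (c ⊔ ℓ ⊔ p)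
    𝓡₂ R R𝓕 x =
      Σ Carrier (λ ρ → R𝓕 ρ ×
        Σ Carrier (λ r → R r × (x zero ≈ ρ * r))) ×
      (∀ (i : Fin 5) → R (x (suc i)))

{-# OPTIONS --safe #-}
-- Write w(α) = α₁₂ α₂₁² α₂₃ α₃₂² α₃₁ α₁₃², a homomorphism 𝓕⁶ → 𝓕, so that
-- H = {α ∈ 𝓕⁶ ∣ w(α) ∈ 𝓕³}. A class of (K^×)⁶ modulo 𝓕⁶ is represented by a
-- unique element of R⁶, and a class of 𝓕⁶ modulo H is determined by the class of
-- w(α) in 𝓕/𝓕³. Since α₁₂ enters w with exponent 1, that class can be moved into
-- the first coordinate: writing x = f·r with f ∈ 𝓕⁶, r ∈ R⁶ and w(f) = ξ³ρ with
-- ρ ∈ R_𝓕, the tuple (ρr₁₂, r₂₁, …, r₁₃) represents x, because (f₁₂ρ⁻¹, f₂₁, …, f₁₃)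
-- has weight ξ³. Conversely, H-equivalent elements of 𝓡₂ agree in the last five
-- coordinates, so the connecting element of H is concentrated in the first
-- coordinate, where it is a cube; this forces equal r's and then equal ρ's.
module Submission where

open import Defs
open import Level using (Level)
open import Algebra.Bundles using (CommutativeRing)
open import Data.Nat as ℕ using (ℕ; suc)
open import Data.Integer as ℤ using (ℤ; +_; -[1+_]; _⊖_)
import Data.Integer.Properties as ℤᵖ
import Data.Nat.Properties as ℕᵖ
open import Data.Fin using (Fin; zero; suc)
open import Data.Fin.Patterns using (0F; 1F; 2F; 3F; 4F; 5F)
open import Data.Product using (Σ; _×_; _,_; proj₁; proj₂)
open import Function using (_∘_)
open import Relation.Binary.PropositionalEquality as ≡ using (_≡_)

module _ {c ℓ : Level} (K : NumberField c ℓ) where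
  open NumberField K
  open CommutativeRing ring hiding (zero)
  open NF K
  open import Relation.Binary.Reasoning.Setoid setoid
  open import Algebra.Solver.CommutativeMonoid *-commutativeMonoid using (solve; _⊕_; _⊜_; id; Expr)
  import Algebra.Properties.Semiring.Exp semiring as Exp
  import Algebra.Properties.CommutativeMonoid.Sum *-commutativeMonoid as Product

  *-inverse-cancelˡ : ∀ {a b} → a * b ≈ 1# → ∀ y → b * (a * y) ≈ y
  *-inverse-cancelˡ {a} {b} ab≈1 y = begin
    b * (a * y)  ≈⟨ solve 3 (λ a b y → b ⊕ (a ⊕ y) ⊜ (a ⊕ b) ⊕ y) refl a b y ⟩
    (a * b) * y  ≈⟨ *-congʳ ab≈1 ⟩
    1# * y       ≈⟨ *-identityˡ y ⟩
    y            ∎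

  NonZero-resp-≈ : ∀ {x y} → x ≈ y → NonZero y → NonZero x
  NonZero-resp-≈ x≈y y≉0 x≈0 = y≉0 (trans (sym x≈y) x≈0)

  NonZero-* : ∀ {x y} → NonZero x → NonZero y → NonZero (x * y)
  NonZero-* {x} {y} x≉0 y≉0 xy≈0 with inverse x x≉0
  ... | x⁻¹ , xx⁻¹≈1 = y≉0 (begin
    y              ≈⟨ *-inverse-cancelˡ xx⁻¹≈1 y ⟨
    x⁻¹ * (x * y)  ≈⟨ *-congˡ xy≈0 ⟩
    x⁻¹ * 0#       ≈⟨ zeroʳ x⁻¹ ⟩
    0#             ∎)

  *-cancelʳ-NonZero : ∀ {x y z} → NonZero z → x * z ≈ y * z → x ≈ y
  *-cancelʳ-NonZero {x} {y} {z} z≉0 xz≈yz with inverse z z≉0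
  ... | z⁻¹ , zz⁻¹≈1 = begin
    x              ≈⟨ *-inverse-cancelˡ zz⁻¹≈1 x ⟨
    z⁻¹ * (z * x)  ≈⟨ *-congˡ (trans (*-comm z x) (trans xz≈yz (*-comm y z))) ⟩
    z⁻¹ * (z * y)  ≈⟨ *-inverse-cancelˡ zz⁻¹≈1 y ⟩
    y              ∎

  ^≡Exp^ : ∀ x n → x ^ n ≡ x Exp.^ n
  ^≡Exp^ x ℕ.zero  = ≡.refl
  ^≡Exp^ x (suc n) = ≡.cong (x *_) (^≡Exp^ x n)

  ^-homo-* : ∀ x m n → x ^ m * x ^ n ≈ x ^ (m ℕ.+ n)
  ^-homo-* x m n rewrite ^≡Exp^ x m | ^≡Exp^ x n | ^≡Exp^ x (m ℕ.+ n) =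
    sym (Exp.^-homo-* x m n)

  ^-congˡ : ∀ n {x y} → x ≈ y → x ^ n ≈ y ^ n
  ^-congˡ ℕ.zero  x≈y = refl
  ^-congˡ (suc n) x≈y = *-cong x≈y (^-congˡ n x≈y)

  ∏≡product : ∀ {n} (f : Fin n → Carrier) → ∏ f ≡ Product.sum f
  ∏≡product {ℕ.zero} f = ≡.refl
  ∏≡product {suc n}  f = ≡.cong (f zero *_) (∏≡product (f ∘ suc))

  ∏-cong : ∀ {n} {f g : Fin n → Carrier} → (∀ i → f i ≈ g i) → ∏ f ≈ ∏ g
  ∏-cong {f = f} {g} f≈g rewrite ∏≡product f | ∏≡product g = Product.sum-cong-≋ f≈g

  ∏-distrib-* : ∀ {n} (f g : Fin n → Carrier) → ∏ f * ∏ g ≈ ∏ (λ i → f i * g i)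
  ∏-distrib-* f g rewrite ∏≡product f | ∏≡product g | ∏≡product (λ i → f i * g i) =
    sym (Product.∑-distrib-+ f g)

  ∏-1 : ∀ n → ∏ {n} (λ _ → 1#) ≈ 1#
  ∏-1 n rewrite ∏≡product {n} (λ _ → 1#) = Product.sum-replicate-zero n

  module UnitPower {u v : Carrier} (uv≈1 : u * v ≈ 1#) where

    pow : ℤ → Carrier
    pow (+ n)    = u ^ n
    pow -[1+ n ] = v ^ suc n

    pow-⊖ : ∀ m n → u ^ m * v ^ n ≈ pow (m ⊖ n)
    pow-⊖ ℕ.zero  ℕ.zero  = *-identityˡ 1#
    pow-⊖ ℕ.zero  (suc n) = *-identityˡ (v ^ suc n)
    pow-⊖ (suc m) ℕ.zero  = *-identityʳ (u ^ suc m)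
    pow-⊖ (suc m) (suc n) = begin
      (u * u ^ m) * (v * v ^ n)  ≈⟨ solve 4 (λ u uᵐ v vⁿ → (u ⊕ uᵐ) ⊕ (v ⊕ vⁿ) ⊜ (u ⊕ v) ⊕ (uᵐ ⊕ vⁿ)) refl u (u ^ m) v (v ^ n) ⟩
      (u * v) * (u ^ m * v ^ n)  ≈⟨ *-cong uv≈1 (pow-⊖ m n) ⟩
      1# * pow (m ⊖ n)           ≈⟨ *-identityˡ (pow (m ⊖ n)) ⟩
      pow (m ⊖ n)                ≡⟨ ≡.cong pow (ℤᵖ.[1+m]⊖[1+n]≡m⊖n m n) ⟨
      pow (suc m ⊖ suc n)        ∎

    pow-+ : ∀ a b → pow a * pow b ≈ pow (a ℤ.+ b)
    pow-+ (+ m)    (+ n)    = ^-homo-* u m n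
    pow-+ (+ m)    -[1+ n ] = pow-⊖ m (suc n)
    pow-+ -[1+ m ] (+ n)    = trans (*-comm (v ^ suc m) (u ^ n)) (pow-⊖ n (suc m))
    pow-+ -[1+ m ] -[1+ n ] = begin
      v ^ suc m * v ^ suc n  ≈⟨ ^-homo-* v (suc m) (suc n) ⟩
      v ^ suc (m ℕ.+ suc n)  ≡⟨ ≡.cong (λ k → v ^ suc k) (ℕᵖ.+-suc m n) ⟩
      v ^ suc (suc (m ℕ.+ n)) ∎

  module _ (fu : FundamentalUnits) where
    open FundamentalUnits fu

    εpow : Fin rank → ℤ → Carrier
    εpow i = UnitPower.pow (proj₂ (proj₂ (proj₂ (ε-unit i))))

    private
      -- The powers multiplied in monomial are computed by a function local to
      -- Defs; unification against a constant exponent vector gives it a name.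
      monomialFactor : Σ (Fin rank → ℤ → Carrier) λ pow →
        (λ z → monomial (λ _ → z)) ≡ (λ z → ∏ (λ i → pow i z))
      monomialFactor = _ , ≡.refl

      monomialFactor≈εpow : ∀ i z → proj₁ monomialFactor i z ≈ εpow i z
      monomialFactor≈εpow i (+ n)    = refl
      monomialFactor≈εpow i -[1+ n ] = refl

    monomial≈∏εpow : ∀ a → monomial a ≈ ∏ (λ i → εpow i (a i))
    monomial≈∏εpow a = ∏-cong (λ i → monomialFactor≈εpow i (a i))

    monomial-cong : ∀ {a b} → (∀ i → a i ≡ b i) → monomial a ≈ monomial b
    monomial-cong {a} {b} a≡b = begin
      monomial a                ≈⟨ monomial≈∏εpow a ⟩
      ∏ (λ i → εpow i (a i))    ≈⟨ ∏-cong (λ i → reflexive (≡.cong (εpow i) (a≡b i))) ⟩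
      ∏ (λ i → εpow i (b i))    ≈⟨ monomial≈∏εpow b ⟨
      monomial b                ∎

    monomial-+ : ∀ a b → monomial a * monomial b ≈ monomial (λ i → a i ℤ.+ b i)
    monomial-+ a b = begin
      monomial a * monomial b                        ≈⟨ *-cong (monomial≈∏εpow a) (monomial≈∏εpow b) ⟩
      ∏ (λ i → εpow i (a i)) * ∏ (λ i → εpow i (b i))  ≈⟨ ∏-distrib-* (λ i → εpow i (a i)) (λ i → εpow i (b i)) ⟩
      ∏ (λ i → εpow i (a i) * εpow i (b i))          ≈⟨ ∏-cong (λ i → UnitPower.pow-+ (proj₂ (proj₂ (proj₂ (ε-unit i)))) (a i) (b i)) ⟩
      ∏ (λ i → εpow i (a i ℤ.+ b i))                 ≈⟨ monomial≈∏εpow (λ i → a i ℤ.+ b i) ⟨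
      monomial (λ i → a i ℤ.+ b i)                   ∎

    monomial-0 : monomial (λ _ → + 0) ≈ 1#
    monomial-0 = trans (monomial≈∏εpow (λ _ → + 0)) (∏-1 rank)

    monomial-inverse : ∀ a → monomial a * monomial (λ i → ℤ.- a i) ≈ 1#
    monomial-inverse a = begin
      monomial a * monomial (λ i → ℤ.- a i)  ≈⟨ monomial-+ a (λ i → ℤ.- a i) ⟩
      monomial (λ i → a i ℤ.+ ℤ.- a i)       ≈⟨ monomial-cong (λ i → ℤᵖ.+-inverseʳ (a i)) ⟩
      monomial (λ _ → + 0)                   ≈⟨ monomial-0 ⟩
      1#                                     ∎

    InF-1 : InF fu 1#
    InF-1 = (λ _ → + 0) , sym monomial-0

    InF-* : ∀ {x y} → InF fu x → InF fu y → InF fu (x * y)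
    InF-* (a , x≈εᵃ) (b , y≈εᵇ) = (λ i → a i ℤ.+ b i) , trans (*-cong x≈εᵃ y≈εᵇ) (monomial-+ a b)

    InF-^ : ∀ {x} n → InF fu x → InF fu (x ^ n)
    InF-^ ℕ.zero  x∈F = InF-1
    InF-^ (suc n) x∈F = InF-* x∈F (InF-^ n x∈F)

    InF-inverse : ∀ {x} → InF fu x → Σ Carrier λ y → InF fu y × (x * y ≈ 1#)
    InF-inverse (a , x≈εᵃ) =
      monomial (λ i → ℤ.- a i) , ((λ i → ℤ.- a i) , refl) , trans (*-congʳ x≈εᵃ) (monomial-inverse a)

    InF⇒NonZero : ∀ {x} → InF fu x → NonZero x
    InF⇒NonZero {x} x∈F x≈0 with InF-inverse x∈F
    ... | x⁻¹ , _ , xx⁻¹≈1 = 1≉0 (begin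
      1#         ≈⟨ xx⁻¹≈1 ⟨
      x * x⁻¹    ≈⟨ *-congʳ x≈0 ⟩
      0# * x⁻¹   ≈⟨ zeroˡ x⁻¹ ⟩
      0#         ∎)

    ∼F-cancel : ∀ {u w x y} → InF fu u → InF fu w → u * x ≈ w * y → _∼F_ fu x y
    ∼F-cancel {u} {w} {x} {y} u∈F w∈F ux≈wy with InF-inverse u∈F
    ... | u⁻¹ , u⁻¹∈F , uu⁻¹≈1 = u⁻¹ * w , InF-* u⁻¹∈F w∈F , (begin
      x              ≈⟨ *-inverse-cancelˡ uu⁻¹≈1 x ⟨
      u⁻¹ * (u * x)  ≈⟨ *-congˡ ux≈wy ⟩
      u⁻¹ * (w * y)  ≈⟨ *-assoc u⁻¹ w y ⟨
      (u⁻¹ * w) * y  ∎)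

    weight : Tuple6 fu → Carrier
    weight α = α 0F * (α 1F ^ 2) * α 2F * (α 3F ^ 2) * α 4F * (α 5F ^ 2)

    weightᴱ : ∀ {n} → (a₀ a₁ a₂ a₃ a₄ a₅ : Expr n) → Expr n
    weightᴱ a₀ a₁ a₂ a₃ a₄ a₅ = ((((a₀ ⊕ (a₁ ⊕ (a₁ ⊕ id))) ⊕ a₂) ⊕ (a₃ ⊕ (a₃ ⊕ id))) ⊕ a₄) ⊕ (a₅ ⊕ (a₅ ⊕ id))

    InF-weight : ∀ {α} → (∀ i → InF fu (α i)) → InF fu (weight α)
    InF-weight α∈F =
      InF-* (InF-* (InF-* (InF-* (InF-* (α∈F 0F) (InF-^ 2 (α∈F 1F))) (α∈F 2F)) (InF-^ 2 (α∈F 3F))) (α∈F 4F)) (InF-^ 2 (α∈F 5F))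

    weight-cong : ∀ {α β} → _≋6_ fu α β → weight α ≈ weight β
    weight-cong α≋β =
      *-cong (*-cong (*-cong (*-cong (*-cong (α≋β 0F) (^-congˡ 2 (α≋β 1F))) (α≋β 2F)) (^-congˡ 2 (α≋β 3F))) (α≋β 4F)) (^-congˡ 2 (α≋β 5F))

    scale₀ : Carrier → Tuple6 fu → Tuple6 fu
    scale₀ c α zero    = c * α zero
    scale₀ c α (suc i) = α (suc i)

    weight-scale₀ : ∀ c α → weight (scale₀ c α) ≈ c * weight α
    weight-scale₀ c α = solve 7
      (λ c a₀ a₁ a₂ a₃ a₄ a₅ → weightᴱ (c ⊕ a₀) a₁ a₂ a₃ a₄ a₅ ⊜ c ⊕ weightᴱ a₀ a₁ a₂ a₃ a₄ a₅)
      refl c (α 0F) (α 1F) (α 2F) (α 3F) (α 4F) (α 5F)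

    axis₀ : Carrier → Tuple6 fu
    axis₀ c zero    = c
    axis₀ c (suc _) = 1#

    weight-axis₀ : ∀ c → weight (axis₀ c) ≈ c
    weight-axis₀ c = solve 1 (λ c → weightᴱ c id id id id id ⊜ c) refl c

    weight-on-axis₀ : ∀ {α} → (∀ i → α (suc i) ≈ 1#) → weight α ≈ α 0F
    weight-on-axis₀ {α} αₛ≈1 = trans (weight-cong α≋axis₀) (weight-axis₀ (α 0F))
      where
        α≋axis₀ : _≋6_ fu α (axis₀ (α 0F))
        α≋axis₀ zero    = refl
        α≋axis₀ (suc i) = αₛ≈1 i

    module _ {p} {R R𝓕 : Carrier → Set p} where

      𝓡₂⇒NonZero6 : (∀ r → R r → NonZero r) → (∀ ρ → R𝓕 ρ → InF fu ρ) →
        ∀ s → 𝓡₂ fu R R𝓕 s → NonZero6 fu s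
      𝓡₂⇒NonZero6 R⇒≉0 R𝓕⇒F s ((ρ , ρ∈R𝓕 , r , r∈R , s₀≈ρr) , sₛ∈R) zero =
        NonZero-resp-≈ s₀≈ρr (NonZero-* (InF⇒NonZero (R𝓕⇒F ρ ρ∈R𝓕)) (R⇒≉0 r r∈R))
      𝓡₂⇒NonZero6 R⇒≉0 R𝓕⇒F s (_ , sₛ∈R) (suc i) = R⇒≉0 (s (suc i)) (sₛ∈R i)

      𝓡₂-represents-product : (∀ ρ → R𝓕 ρ → InF fu ρ) →
        (∀ x → InF fu x → Σ Carrier λ ρ → R𝓕 ρ × _∼F³_ fu x ρ) →
        ∀ {x f r} → (∀ i → InF fu (f i)) → (∀ i → R (r i)) → (∀ i → x i ≈ f i * r i) →
        Σ (Tuple6 fu) λ s → 𝓡₂ fu R R𝓕 s × _∼H_ fu x s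
      𝓡₂-represents-product R𝓕⇒F R𝓕-represents {x} {f} {r} f∈F r∈R x≈fr
        with R𝓕-represents (weight f) (InF-weight f∈F)
      ... | ρ , ρ∈R𝓕 , ξ , ξ∈F , wf≈ξ³ρ with InF-inverse (R𝓕⇒F ρ ρ∈R𝓕)
      ... | ρ⁻¹ , ρ⁻¹∈F , ρρ⁻¹≈1 =
        scale₀ ρ r , ((ρ , ρ∈R𝓕 , r 0F , r∈R 0F , refl) , r∈R ∘ suc) ,
        scale₀ ρ⁻¹ f , (h∈F , ξ , ξ∈F , wh≈ξ³) , x≈hs
        where
          h∈F : ∀ i → InF fu (scale₀ ρ⁻¹ f i)
          h∈F zero    = InF-* ρ⁻¹∈F (f∈F 0F)
          h∈F (suc i) = f∈F (suc i)

          wh≈ξ³ : weight (scale₀ ρ⁻¹ f) ≈ ξ ^ 3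
          wh≈ξ³ = begin
            weight (scale₀ ρ⁻¹ f)  ≈⟨ weight-scale₀ ρ⁻¹ f ⟩
            ρ⁻¹ * weight f         ≈⟨ *-congˡ (trans wf≈ξ³ρ (*-comm (ξ ^ 3) ρ)) ⟩
            ρ⁻¹ * (ρ * ξ ^ 3)      ≈⟨ *-inverse-cancelˡ ρρ⁻¹≈1 (ξ ^ 3) ⟩
            ξ ^ 3                  ∎

          x≈hs : ∀ i → x i ≈ scale₀ ρ⁻¹ f i * scale₀ ρ r i
          x≈hs zero = begin
            x 0F                       ≈⟨ x≈fr 0F ⟩
            f 0F * r 0F                ≈⟨ *-congˡ (*-inverse-cancelˡ ρρ⁻¹≈1 (r 0F)) ⟨
            f 0F * (ρ⁻¹ * (ρ * r 0F))  ≈⟨ *-assoc (f 0F) ρ⁻¹ (ρ * r 0F) ⟨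
            (f 0F * ρ⁻¹) * (ρ * r 0F)  ≈⟨ *-congʳ (*-comm (f 0F) ρ⁻¹) ⟩
            (ρ⁻¹ * f 0F) * (ρ * r 0F)  ∎
          x≈hs (suc i) = x≈fr (suc i)

      𝓡₂-represents : (∀ x → NonZero x → Σ Carrier λ r → R r × _∼F_ fu x r) →
        (∀ ρ → R𝓕 ρ → InF fu ρ) → (∀ x → InF fu x → Σ Carrier λ ρ → R𝓕 ρ × _∼F³_ fu x ρ) →
        ∀ x → NonZero6 fu x → Σ (Tuple6 fu) λ s → 𝓡₂ fu R R𝓕 s × _∼H_ fu x s
      𝓡₂-represents R-represents R𝓕⇒F R𝓕-represents x x≉0 =
        𝓡₂-represents-product R𝓕⇒F R𝓕-represents
          (λ i → proj₁ (proj₂ (proj₂ (proj₂ (xᵢ∼r i)))))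
          (λ i → proj₁ (proj₂ (xᵢ∼r i)))
          (λ i → proj₂ (proj₂ (proj₂ (proj₂ (xᵢ∼r i)))))
        where
          xᵢ∼r : ∀ i → Σ Carrier λ r → R r × _∼F_ fu (x i) r
          xᵢ∼r i = R-represents (x i) (x≉0 i)

      𝓡₂-unique : (∀ r → R r → NonZero r) → (∀ r r′ → R r → R r′ → _∼F_ fu r r′ → r ≈ r′) →
        (∀ ρ → R𝓕 ρ → InF fu ρ) → (∀ ρ σ → R𝓕 ρ → R𝓕 σ → _∼F³_ fu ρ σ → ρ ≈ σ) →
        ∀ s t → 𝓡₂ fu R R𝓕 s → 𝓡₂ fu R R𝓕 t → _∼H_ fu s t → _≋6_ fu s t
      𝓡₂-unique R⇒≉0 R-unique R𝓕⇒F R𝓕-unique s t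
        ((ρ , ρ∈R𝓕 , r , r∈R , s₀≈ρr) , sₛ∈R) ((σ , σ∈R𝓕 , r′ , r′∈R , t₀≈σr′) , tₛ∈R)
        (h , (h∈F , ξ , ξ∈F , wh≈ξ³) , s≈ht) = s≋t
        where
          sₛ≈tₛ : ∀ i → s (suc i) ≈ t (suc i)
          sₛ≈tₛ i = R-unique _ _ (sₛ∈R i) (tₛ∈R i) (h (suc i) , h∈F (suc i) , s≈ht (suc i))

          hₛ≈1 : ∀ i → h (suc i) ≈ 1#
          hₛ≈1 i = *-cancelʳ-NonZero (R⇒≉0 _ (tₛ∈R i))
            (trans (sym (s≈ht (suc i))) (trans (sₛ≈tₛ i) (sym (*-identityˡ _))))

          h₀≈ξ³ : h 0F ≈ ξ ^ 3
          h₀≈ξ³ = trans (sym (weight-on-axis₀ {h} hₛ≈1)) wh≈ξ³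

          ρr≈h₀σr′ : ρ * r ≈ (h 0F * σ) * r′
          ρr≈h₀σr′ = begin
            ρ * r              ≈⟨ s₀≈ρr ⟨
            s 0F               ≈⟨ s≈ht 0F ⟩
            h 0F * t 0F        ≈⟨ *-congˡ t₀≈σr′ ⟩
            h 0F * (σ * r′)    ≈⟨ *-assoc (h 0F) σ r′ ⟨
            (h 0F * σ) * r′    ∎

          r≈r′ : r ≈ r′
          r≈r′ = R-unique r r′ r∈R r′∈R
            (∼F-cancel (R𝓕⇒F ρ ρ∈R𝓕) (InF-* (h∈F 0F) (R𝓕⇒F σ σ∈R𝓕)) ρr≈h₀σr′)

          ρ≈σ : ρ ≈ σ
          ρ≈σ = R𝓕-unique ρ σ ρ∈R𝓕 σ∈R𝓕 (ξ , ξ∈F ,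
            *-cancelʳ-NonZero (R⇒≉0 r r∈R) (begin
              ρ * r              ≈⟨ ρr≈h₀σr′ ⟩
              (h 0F * σ) * r′    ≈⟨ *-cong (*-congʳ h₀≈ξ³) (sym r≈r′) ⟩
              (ξ ^ 3 * σ) * r    ∎))

          s≋t : _≋6_ fu s t
          s≋t zero    = trans s₀≈ρr (trans (*-cong ρ≈σ r≈r′) (sym t₀≈σr′))
          s≋t (suc i) = sₛ≈tₛ i

lemma2p5 : ∀ {c ℓ p : Level} (K : NumberField c ℓ) (fu : NF.FundamentalUnits K)
    (R R𝓕 : CommutativeRing.Carrier (NumberField.ring K) → Set p) →
    NF.SystemOfReps K (CommutativeRing._≈_ (NumberField.ring K)) (NF.NonZero K) (NF._∼F_ K fu) R →
    NF.SystemOfReps K (CommutativeRing._≈_ (NumberField.ring K)) (NF.InF K fu) (NF._∼F³_ K fu) R𝓕 →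
    NF.SystemOfReps K (NF._≋6_ K fu) (NF.NonZero6 K fu) (NF._∼H_ K fu) (NF.𝓡₂ K fu R R𝓕)
lemma2p5 K fu R R𝓕 (R⇒≉0 , R-represents , R-unique) (R𝓕⇒F , R𝓕-represents , R𝓕-unique) =
  𝓡₂⇒NonZero6 K fu R⇒≉0 R𝓕⇒F ,
  𝓡₂-represents K fu R-represents R𝓕⇒F R𝓕-represents ,
  𝓡₂-unique K fu R⇒≉0 R-unique R𝓕⇒F R𝓕-unique
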